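{- Let $p$ be an odd prime and $a\in\mathbb Z$. Then the congruence $y_1^4+y_2^4+3y_3^4+5y_4^4+7y_5^4\equiv a\pmod p$ has a solution $(y_1,\dots,y_5)\in\mathbb Z^5$ with not all $y_i$ divisible by $p$. If $p\in\{3,5,7\}$, then such a solution can be chosen so that the variable whose coefficient equals $p$ is zero. -}

module Defs where

open import Data.Nat using (ℕ)
open import Data.Integer using (ℤ; +_; _+_; _*_; _-_; _^_)
open import Data.Integer.Divisibility using (_∣_)
open import Data.Product using (_×_)
open import Relation.Nullary using (¬_)

Q : ℤ → ℤ → ℤ → ℤ → ℤ → ℤ
Q y₁ y₂ y₃ y₄ y₅ = y₁ ^ 4 + y₂ ^ 4 + + 3 * y₃ ^ 4 + + 5 * y₄ ^ 4 + + 7 * y₅ ^ 4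

Sol : ℕ → ℤ → ℤ → ℤ → ℤ → ℤ → ℤ → Set
Sol p a y₁ y₂ y₃ y₄ y₅ =
  (+ p ∣ (Q y₁ y₂ y₃ y₄ y₅ - a)) ×
  ¬ ((+ p ∣ y₁) × (+ p ∣ y₂) × (+ p ∣ y₃) × (+ p ∣ y₄) × (+ p ∣ y₅))

module Submission where

-- For p > 7 take y₁ = 1: it suffices that y₂⁴ + 3y₃⁴ + 5y₄⁴ + 7y₅⁴ takes every value
-- mod p. Let A be the set of residues represented by a diagonal form ∑ cᵢyᵢ⁴ with
-- nonzero coefficients; A contains 0 and is stable under multiplication by nonzero
-- fourth powers. Adding a term c·y⁴ either produces a new value x ∉ A, or else A is
-- closed under adding c and hence is all of ℤ/p. In the first case the whole coset
-- x·(𝔽ₚ×)⁴ is new, and it has at least (p − 1)/4 elements because u ↦ u⁴ is at most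
-- four-to-one on 𝔽ₚ×. Starting from A = {0}, four terms thus reach p residues.
-- For p = 3, 5, 7 solutions with the prescribed zero are listed residue by residue.

module Counting where

  open import Data.Nat
  open import Data.Nat.Properties
  open import Data.Product using (_×_; _,_; ∃-syntax)
  open import Data.Sum using (_⊎_; inj₁; inj₂)
  open import Data.Empty using (⊥)
  open import Function using (_∘_)
  open import Level using (0ℓ)
  open import Relation.Nullary using (Dec; yes; no; ¬_; contradiction)
  open import Relation.Unary using (Pred; Decidable)
  open import Relation.Binary.PropositionalEquality
  open import Algebra.Properties.CommutativeSemigroup +-commutativeSemigroup using (interchange)

  private
    variable
      A B C : Set
      P Q R : Pred ℕ 0ℓ

  ∑< : ℕ → (ℕ → ℕ) → ℕ
  ∑< zero    f = 0
  ∑< (suc n) f = f n + ∑< n f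

  syntax ∑< n (λ i → e) = ∑[ i < n ] e

  ∑<-mono-≤ : ∀ {f g} n → (∀ {i} → i < n → f i ≤ g i) → ∑< n f ≤ ∑< n g
  ∑<-mono-≤ zero    f≤g = z≤n
  ∑<-mono-≤ (suc n) f≤g = +-mono-≤ (f≤g ≤-refl) (∑<-mono-≤ n (f≤g ∘ m<n⇒m<1+n))

  ∑<-cong : ∀ {f g} n → (∀ {i} → i < n → f i ≡ g i) → ∑< n f ≡ ∑< n g
  ∑<-cong zero    f≡g = refl
  ∑<-cong (suc n) f≡g = cong₂ _+_ (f≡g ≤-refl) (∑<-cong n (f≡g ∘ m<n⇒m<1+n))

  ∑<-zero : ∀ n → ∑[ i < n ] 0 ≡ 0
  ∑<-zero zero    = refl
  ∑<-zero (suc n) = ∑<-zero n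

  ∑<-one : ∀ n → ∑[ i < n ] 1 ≡ n
  ∑<-one zero    = refl
  ∑<-one (suc n) = cong suc (∑<-one n)

  ∑<-distrib-+ : ∀ f g n → ∑[ i < n ] (f i + g i) ≡ ∑< n f + ∑< n g
  ∑<-distrib-+ f g zero    = refl
  ∑<-distrib-+ f g (suc n) = begin
    f n + g n + ∑[ i < n ] (f i + g i) ≡⟨ cong (f n + g n +_) (∑<-distrib-+ f g n) ⟩
    f n + g n + (∑< n f + ∑< n g)      ≡⟨ interchange (f n) (g n) (∑< n f) (∑< n g) ⟩
    f n + ∑< n f + (g n + ∑< n g)      ∎
    where open ≡-Reasoning

  ∑<-distribˡ-* : ∀ k f n → ∑[ i < n ] (k * f i) ≡ k * ∑< n f
  ∑<-distribˡ-* k f zero    = sym (*-zeroʳ k)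
  ∑<-distribˡ-* k f (suc n) =
    trans (cong (k * f n +_) (∑<-distribˡ-* k f n)) (sym (*-distribˡ-+ k (f n) (∑< n f)))

  ∑<-comm : ∀ (F : ℕ → ℕ → ℕ) n m → ∑[ i < n ] ∑[ j < m ] F i j ≡ ∑[ j < m ] ∑[ i < n ] F i j
  ∑<-comm F zero    m = sym (∑<-zero m)
  ∑<-comm F (suc n) m = trans (cong (∑< m (F n) +_) (∑<-comm F n m))
                              (sym (∑<-distrib-+ (F n) (λ j → ∑[ i < n ] F i j) m))

  indicator : Dec A → ℕ
  indicator (yes _) = 1
  indicator (no  _) = 0

  indicator-mono : (A → B) → (a? : Dec A) (b? : Dec B) → indicator a? ≤ indicator b?
  indicator-mono A→B (no _)  _       = z≤n
  indicator-mono A→B (yes _) (yes _) = ≤-refl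
  indicator-mono A→B (yes a) (no ¬b) = contradiction (A→B a) ¬b

  indicator-⊎ : (A → B ⊎ C) → (a? : Dec A) (b? : Dec B) (c? : Dec C) →
                indicator a? ≤ indicator b? + indicator c?
  indicator-⊎ A→B⊎C (no _)  _       _  = z≤n
  indicator-⊎ A→B⊎C (yes _) (yes _) _  = s≤s z≤n
  indicator-⊎ A→B⊎C (yes a) (no ¬b) c? with A→B⊎C a
  ... | inj₁ b = contradiction b ¬b
  ... | inj₂ c = indicator-mono (λ _ → c) (yes a) c?

  indicator-disjoint : (A → C) → (B → C) → (A → B → ⊥) →
                       (a? : Dec A) (b? : Dec B) (c? : Dec C) →
                       indicator a? + indicator b? ≤ indicator c?
  indicator-disjoint A→C B→C disj (yes a) (yes b) c? = contradiction b (disj a)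
  indicator-disjoint A→C B→C disj (yes a) (no _)  c? = indicator-mono A→C (yes a) c?
  indicator-disjoint A→C B→C disj (no _)  b?      c? = indicator-mono B→C b? c?

  count : Decidable P → ℕ → ℕ
  count P? n = ∑[ i < n ] indicator (P? i)

  count-mono-≤ : ∀ (P? : Decidable P) (Q? : Decidable Q) n →
                 (∀ {i} → i < n → P i → Q i) → count P? n ≤ count Q? n
  count-mono-≤ P? Q? n P⇒Q = ∑<-mono-≤ n λ {i} i<n → indicator-mono (P⇒Q i<n) (P? i) (Q? i)

  count-⊎ : ∀ (P? : Decidable P) (Q? : Decidable Q) (R? : Decidable R) n →
            (∀ {i} → i < n → P i → Q i ⊎ R i) → count P? n ≤ count Q? n + count R? n
  count-⊎ P? Q? R? n P⇒Q⊎R = begin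
    count P? n
      ≤⟨ ∑<-mono-≤ n (λ {i} i<n → indicator-⊎ (P⇒Q⊎R i<n) (P? i) (Q? i) (R? i)) ⟩
    ∑[ i < n ] (indicator (Q? i) + indicator (R? i))
      ≡⟨ ∑<-distrib-+ _ _ n ⟩
    count Q? n + count R? n
      ∎
    where open ≤-Reasoning

  count-disjoint : ∀ (P? : Decidable P) (Q? : Decidable Q) (R? : Decidable R) n →
                   (∀ {i} → i < n → P i → R i) → (∀ {i} → i < n → Q i → R i) →
                   (∀ {i} → i < n → P i → Q i → ⊥) → count P? n + count Q? n ≤ count R? n
  count-disjoint P? Q? R? n P⇒R Q⇒R disj = begin
    count P? n + count Q? n
      ≡⟨ ∑<-distrib-+ _ _ n ⟨
    ∑[ i < n ] (indicator (P? i) + indicator (Q? i))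
      ≤⟨ ∑<-mono-≤ n (λ {i} i<n →
           indicator-disjoint (P⇒R i<n) (Q⇒R i<n) (disj i<n) (P? i) (Q? i) (R? i)) ⟩
    count R? n
      ∎
    where open ≤-Reasoning

  count≤n : ∀ (P? : Decidable P) n → count P? n ≤ n
  count≤n P? zero    = z≤n
  count≤n P? (suc n) with P? n
  ... | yes _ = s≤s (count≤n P? n)
  ... | no  _ = m≤n⇒m≤1+n (count≤n P? n)

  count≡0 : ∀ (P? : Decidable P) n → (∀ {i} → i < n → ¬ P i) → count P? n ≡ 0
  count≡0 P? zero    ¬P = refl
  count≡0 P? (suc n) ¬P with P? n
  ... | yes Pn = contradiction Pn (¬P ≤-refl)
  ... | no  _  = count≡0 P? n (¬P ∘ m<n⇒m<1+n)

  count≥n⇒all : ∀ (P? : Decidable P) n → n ≤ count P? n → ∀ {i} → i < n → P i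
  count≥n⇒all P? (suc n) n≤count {i} i<1+n with P? n
  ... | no  _  = contradiction n≤count (<⇒≱ (s≤s (count≤n P? n)))
  ... | yes Pn with m≤n⇒m<n∨m≡n (≤-pred i<1+n)
  ...   | inj₁ i<n  = count≥n⇒all P? n (≤-pred n≤count) i<n
  ...   | inj₂ refl = Pn

  count-unique : ∀ (P? : Decidable P) n → (∀ {i j} → i < n → j < n → P i → P j → i ≡ j) →
                 count P? n ≤ 1
  count-unique P? zero    unique = z≤n
  count-unique P? (suc n) unique with P? n
  ... | no  _  = count-unique P? n λ i<n j<n → unique (m<n⇒m<1+n i<n) (m<n⇒m<1+n j<n)
  ... | yes Pn = ≤-reflexive (cong suc (count≡0 P? n λ i<n Pi →
                   <-irrefl (unique (m<n⇒m<1+n i<n) ≤-refl Pi Pn) i<n))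

  count-≡ : ∀ {v n} → v < n → count (v ≟_) n ≡ 1
  count-≡ {v} {suc n} v<1+n with v ≟ n
  ... | yes refl = cong suc (count≡0 (v ≟_) n λ i<v v≡i → <-irrefl (sym v≡i) i<v)
  ... | no  v≢n  = count-≡ (≤∧≢⇒< (≤-pred v<1+n) v≢n)

  count≤-fromWitness : ∀ (P? : Decidable P) n {k} →
                       (∀ {i} → i < n → P i → count P? n ≤ k) → count P? n ≤ k
  count≤-fromWitness P? n bound with anyUpTo? P? n
  ... | yes (i , i<n , Pi) = bound i<n Pi
  ... | no  ∄i             = subst (_≤ _) (sym (count≡0 P? n λ i<n Pi → ∄i (_ , i<n , Pi))) z≤n

  Image : (ℕ → ℕ) → ℕ → Pred ℕ 0ℓ
  Image g n z = ∃[ t ] t < n × g t ≡ z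

  image? : ∀ g n → Decidable (Image g n)
  image? g n z = anyUpTo? (λ t → g t ≟ z) n

  count-image : ∀ g n m k → (∀ {t} → t < n → g t < m) →
                (∀ z → count (λ t → g t ≟ z) n ≤ k) → n ≤ k * count (image? g n) m
  count-image g n m k g<m fibre≤k = begin
    n                                         ≡⟨ ∑<-one n ⟨
    ∑[ t < n ] 1                              ≡⟨ ∑<-cong n (λ t<n → count-≡ (g<m t<n)) ⟨
    ∑[ t < n ] ∑[ z < m ] indicator (g t ≟ z) ≡⟨ ∑<-comm _ n m ⟩
    ∑[ z < m ] count (λ t → g t ≟ z) n        ≤⟨ ∑<-mono-≤ m (λ {z} _ → fibre≤ z) ⟩
    ∑[ z < m ] (k * indicator (image? g n z)) ≡⟨ ∑<-distribˡ-* k _ m ⟩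
    k * count (image? g n) m                  ∎
    where
    open ≤-Reasoning
    fibre≤ : ∀ z → count (λ t → g t ≟ z) n ≤ k * indicator (image? g n z)
    fibre≤ z with image? g n z
    ... | yes _ = subst (_ ≤_) (sym (*-identityʳ k)) (fibre≤k z)
    ... | no ∄t = ≤-reflexive (trans (count≡0 (λ t → g t ≟ z) n λ t<n gt≡z → ∄t (_ , t<n , gt≡z))
                                     (sym (*-zeroʳ k)))

open import Defs
open import Data.Nat as ℕ using (ℕ; zero; suc; NonZero; z≤n; s≤s)
import Data.Nat.Properties as ℕ
import Data.Nat.Divisibility as ℕ
open import Data.Nat.Primality
  using (Prime; euclidsLemma; prime⇒nonZero; prime⇒irreducible; ¬prime[0]; ¬prime[1])
open import Data.Nat.Coprimality using (Coprime; prime⇒coprime; coprime-Bézout)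
open import Data.Nat.GCD using (module Bézout)
open import Data.Integer using (ℤ; +_; 0ℤ; 1ℤ; _+_; _*_; _-_; -_; _^_; ∣_∣)
open import Data.Integer.Properties
  using (+-identityʳ; *-identityʳ; *-assoc; neg-involutive; neg-distribˡ-*; abs-*; pos-+; pos-*;
         m-n≡m⊖n; ∣⊖∣-≤; ^-*-assoc; +-*-commutativeSemiring)
open import Algebra.Properties.CommutativeSemiring.Exp +-*-commutativeSemiring using (^-distrib-*)
open import Data.Integer.Divisibility.Signed
  using (_∣_; _∣?_; divides; ∣m⇒∣-m; ∣m∣n⇒∣m+n; ∣m⇒∣m*n; ∣n⇒∣m*n; ∣⇒∣ᵤ; ∣ᵤ⇒∣)
open import Data.Integer.DivMod using (_%ℕ_; _/ℕ_; n%ℕd<d; a≡a%ℕn+[a/ℕn]*n)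
open import Data.Integer.Tactic.RingSolver using (solve-∀)
open import Data.List using (List; []; _∷_; length)
open import Data.List.Relation.Unary.All using (All; []; _∷_)
open import Data.Product using (_×_; _,_; ∃-syntax)
open import Data.Sum using (_⊎_; inj₁; inj₂)
import Data.Sum as Sum
open import Data.Empty using (⊥)
open import Function using (_∘_; flip)
open import Level using (0ℓ)
open import Relation.Nullary using (Dec; yes; no; ¬_; ¬?; contradiction)
open import Relation.Nullary.Decidable using (map′; _×-dec_; decidable-stable)
open import Relation.Unary using (Decidable)
open import Relation.Binary.Bundles using (Setoid)
open import Relation.Binary.Structures using (IsEquivalence)
import Relation.Binary.Reasoning.Setoid as SetoidReasoning
open import Relation.Binary.PropositionalEquality
open Counting

pos-+-* : ∀ i j k → + (i ℕ.+ j ℕ.* k) ≡ + i + + j * + k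
pos-+-* i j k = trans (pos-+ i (j ℕ.* k)) (cong (_+_ (+ i)) (pos-* j k))

module Congruence (p : ℕ) .{{_ : NonZero p}} where

  infix 4 _≈_ _≈?_

  record _≈_ (x y : ℤ) : Set where
    constructor mk≈
    field p∣x-y : + p ∣ x - y

  open _≈_ public

  _≈?_ : ∀ x y → Dec (x ≈ y)
  x ≈? y = map′ mk≈ p∣x-y (+ p ∣? x - y)

  ≈-by : ∀ {x y d} → + p ∣ d → d ≡ x - y → x ≈ y
  ≈-by p∣d refl = mk≈ p∣d

  ≈-refl : ∀ {x} → x ≈ x
  ≈-refl {x} = ≈-by (divides 0ℤ refl) (identity x)
    where
    identity : ∀ x → 0ℤ ≡ x - x
    identity = solve-∀

  ≈-reflexive : ∀ {x y} → x ≡ y → x ≈ y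
  ≈-reflexive refl = ≈-refl

  ≈-sym : ∀ {x y} → x ≈ y → y ≈ x
  ≈-sym {x} {y} (mk≈ d) = ≈-by (∣m⇒∣-m d) (identity x y)
    where
    identity : ∀ x y → - (x - y) ≡ y - x
    identity = solve-∀

  ≈-trans : ∀ {x y z} → x ≈ y → y ≈ z → x ≈ z
  ≈-trans {x} {y} {z} (mk≈ d) (mk≈ e) = ≈-by (∣m∣n⇒∣m+n d e) (identity x y z)
    where
    identity : ∀ x y z → (x - y) + (y - z) ≡ x - z
    identity = solve-∀

  ≈-isEquivalence : IsEquivalence _≈_
  ≈-isEquivalence = record { refl = ≈-refl ; sym = ≈-sym ; trans = ≈-trans }

  ≈-setoid : Setoid 0ℓ 0ℓ
  ≈-setoid = record { isEquivalence = ≈-isEquivalence }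

  module ≈-Reasoning = SetoidReasoning ≈-setoid

  +-cong : ∀ {x x′ y y′} → x ≈ x′ → y ≈ y′ → x + y ≈ x′ + y′
  +-cong {x} {x′} {y} {y′} (mk≈ d) (mk≈ e) = ≈-by (∣m∣n⇒∣m+n d e) (identity x x′ y y′)
    where
    identity : ∀ x x′ y y′ → (x - x′) + (y - y′) ≡ (x + y) - (x′ + y′)
    identity = solve-∀

  -‿cong : ∀ {x x′} → x ≈ x′ → - x ≈ - x′
  -‿cong {x} {x′} (mk≈ d) = ≈-by (∣m⇒∣-m d) (identity x x′)
    where
    identity : ∀ x x′ → - (x - x′) ≡ - x - - x′
    identity = solve-∀

  -‿congʳ : ∀ x {y y′} → y ≈ y′ → x - y ≈ x - y′
  -‿congʳ x y≈y′ = +-cong (≈-refl {x}) (-‿cong y≈y′)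

  *-congʳ : ∀ {x x′} y → x ≈ x′ → x * y ≈ x′ * y
  *-congʳ {x} {x′} y (mk≈ d) = ≈-by (∣m⇒∣m*n y d) (identity x x′ y)
    where
    identity : ∀ x x′ y → (x - x′) * y ≡ x * y - x′ * y
    identity = solve-∀

  *-congˡ : ∀ x {y y′} → y ≈ y′ → x * y ≈ x * y′
  *-congˡ x {y} {y′} (mk≈ d) = ≈-by (∣n⇒∣m*n x d) (identity x y y′)
    where
    identity : ∀ x y y′ → x * (y - y′) ≡ x * y - x * y′
    identity = solve-∀

  ^-cong : ∀ {x y} n → x ≈ y → x ^ n ≈ y ^ n
  ^-cong         zero    x≈y = ≈-refl
  ^-cong {x} {y} (suc n) x≈y = ≈-trans (*-congʳ (x ^ n) x≈y) (*-congˡ y (^-cong n x≈y))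

  ∣⇒≈0 : ∀ {x} → + p ∣ x → x ≈ 0ℤ
  ∣⇒≈0 {x} d = ≈-by d (sym (+-identityʳ x))

  ≈0⇒∣ : ∀ {x} → x ≈ 0ℤ → + p ∣ x
  ≈0⇒∣ {x} (mk≈ d) = subst (+ p ∣_) (+-identityʳ x) d

  ≈⇒-≈0 : ∀ {x y} → x ≈ y → x - y ≈ 0ℤ
  ≈⇒-≈0 = ∣⇒≈0 ∘ p∣x-y

  -≈0⇒≈ : ∀ {x y} → x - y ≈ 0ℤ → x ≈ y
  -≈0⇒≈ = mk≈ ∘ ≈0⇒∣

  +≈0⇒≈- : ∀ {x y} → x + y ≈ 0ℤ → x ≈ - y
  +≈0⇒≈- {x} {y} x+y≈0 =
    mk≈ (subst (+ p ∣_) (cong (_+_ x) (sym (neg-involutive y))) (≈0⇒∣ x+y≈0))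

  +-multiple-≈ : ∀ i k → + (i ℕ.+ k ℕ.* p) ≈ + i
  +-multiple-≈ i k = ≈-by (divides (+ k) refl) (begin
    + k * + p               ≡⟨ identity (+ i) (+ k) (+ p) ⟩
    + i + + k * + p - + i   ≡⟨ cong (_- + i) (pos-+-* i k p) ⟨
    + (i ℕ.+ k ℕ.* p) - + i ∎)
    where
    open ≡-Reasoning
    identity : ∀ i k p → k * p ≡ i + k * p - i
    identity = solve-∀

  coprime⇒invertible : ∀ {m} → Coprime p m → ∃[ s ] s * + m ≈ 1ℤ
  coprime⇒invertible {m} p⊥m with coprime-Bézout p⊥m
  ... | Bézout.+- a b 1+bm≡ap = - + b , (begin
    - + b * + m   ≡⟨ neg-distribˡ-* (+ b) (+ m) ⟨
    - (+ b * + m) ≈⟨ ≈-sym (+≈0⇒≈- 1+bm≈0) ⟩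
    1ℤ            ∎)
    where
    open ≈-Reasoning
    1+bm≈0 : + 1 + + b * + m ≈ 0ℤ
    1+bm≈0 = ≈-trans (≈-reflexive (trans (sym (pos-+-* 1 b m)) (cong +_ 1+bm≡ap))) (+-multiple-≈ 0 a)
  ... | Bézout.-+ a b 1+ap≡bm = + b , (begin
    + b * + m         ≡⟨ pos-* b m ⟨
    + (b ℕ.* m)       ≡⟨ cong +_ 1+ap≡bm ⟨
    + (1 ℕ.+ a ℕ.* p) ≈⟨ +-multiple-≈ 1 a ⟩
    1ℤ                ∎)
    where open ≈-Reasoning

  residue : ℤ → ℕ
  residue x = x %ℕ p

  residue<p : ∀ x → residue x ℕ.< p
  residue<p x = n%ℕd<d x p

  ≈-residue : ∀ x → x ≈ + residue x
  ≈-residue x = ≈-by (divides (x /ℕ p) refl) (begin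
    x /ℕ p * + p                             ≡⟨ identity (+ residue x) (x /ℕ p) (+ p) ⟩
    + residue x + x /ℕ p * + p - + residue x ≡⟨ cong (_- + residue x) (a≡a%ℕn+[a/ℕn]*n x p) ⟨
    x - + residue x                          ∎)
    where
    open ≡-Reasoning
    identity : ∀ r q p → q * p ≡ r + q * p - r
    identity = solve-∀

  residue-≡⇒≈ : ∀ {x y} → residue x ≡ residue y → x ≈ y
  residue-≡⇒≈ {x} {y} eq =
    ≈-trans (≈-residue x) (≈-trans (≈-reflexive (cong +_ eq)) (≈-sym (≈-residue y)))

  ≤-≈⇒≡ : ∀ {i j} → i ℕ.≤ j → j ℕ.< p → + i ≈ + j → i ≡ j
  ≤-≈⇒≡ {i} {j} i≤j j<p (mk≈ d) with j ℕ.∸ i in j-i≡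
  ... | zero  = ℕ.≤-antisym i≤j (ℕ.m∸n≡0⇒m≤n j-i≡)
  ... | suc k = contradiction (ℕ.∣⇒≤ p∣1+k) (ℕ.<⇒≱ 1+k<p)
    where
    p∣1+k : p ℕ.∣ suc k
    p∣1+k = subst (p ℕ.∣_) (trans (cong ∣_∣ (m-n≡m⊖n i j)) (trans (∣⊖∣-≤ i≤j) j-i≡)) (∣⇒∣ᵤ d)
    1+k<p : suc k ℕ.< p
    1+k<p = subst (ℕ._< p) j-i≡ (ℕ.≤-<-trans (ℕ.m∸n≤m j i) j<p)

  ≈⇒≡ : ∀ {i j} → i ℕ.< p → j ℕ.< p → + i ≈ + j → i ≡ j
  ≈⇒≡ {i} {j} i<p j<p i≈j with ℕ.≤-total i j
  ... | inj₁ i≤j = ≤-≈⇒≡ i≤j j<p i≈j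
  ... | inj₂ j≤i = sym (≤-≈⇒≡ j≤i i<p (≈-sym i≈j))

  0<m<p⇒m≉0 : ∀ {m} → 0 ℕ.< m → m ℕ.< p → ¬ + m ≈ 0ℤ
  0<m<p⇒m≉0 {suc m} _ m<p m≈0 = contradiction (≈⇒≡ m<p (ℕ.>-nonZero⁻¹ p) m≈0) λ ()

module PrimeModulus (p : ℕ) (p-prime : Prime p) where

  private instance
    p≢0 : NonZero p
    p≢0 = prime⇒nonZero p-prime

  open Congruence p public

  x*y≈0⇒x≈0∨y≈0 : ∀ x y → x * y ≈ 0ℤ → x ≈ 0ℤ ⊎ y ≈ 0ℤ
  x*y≈0⇒x≈0∨y≈0 x y xy≈0 = Sum.map (∣⇒≈0 ∘ ∣ᵤ⇒∣) (∣⇒≈0 ∘ ∣ᵤ⇒∣)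
    (euclidsLemma ∣ x ∣ ∣ y ∣ p-prime (subst (p ℕ.∣_) (abs-* x y) (∣⇒∣ᵤ (≈0⇒∣ xy≈0))))

  *-cancelˡ-≈ : ∀ {x y y′} → ¬ x ≈ 0ℤ → x * y ≈ x * y′ → y ≈ y′
  *-cancelˡ-≈ {x} {y} {y′} x≉0 xy≈xy′ = Sum.[ flip contradiction x≉0 , -≈0⇒≈ {y} {y′} ]′
    (x*y≈0⇒x≈0∨y≈0 x (y - y′) (subst (_≈ 0ℤ) (identity x y y′) (≈⇒-≈0 xy≈xy′)))
    where
    identity : ∀ x y y′ → x * y - x * y′ ≡ x * (y - y′)
    identity = solve-∀

  x²≈y²⇒x≈±y : ∀ x y → x ^ 2 ≈ y ^ 2 → x ≈ y ⊎ x ≈ - y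
  x²≈y²⇒x≈±y x y x²≈y² = Sum.map (-≈0⇒≈ {x} {y}) (+≈0⇒≈- {x} {y})
    (x*y≈0⇒x≈0∨y≈0 (x - y) (x + y) (subst (_≈ 0ℤ) (identity x y) (≈⇒-≈0 x²≈y²)))
    where
    -- The ring solver does not accept Data.Integer._^_, so the square is written out.
    identity : ∀ x y → x * (x * 1ℤ) - y * (y * 1ℤ) ≡ (x - y) * (x + y)
    identity = solve-∀

  x⁴≈y⁴⇒x²≈±y² : ∀ x y → x ^ 4 ≈ y ^ 4 → x ^ 2 ≈ y ^ 2 ⊎ x ^ 2 ≈ - y ^ 2
  x⁴≈y⁴⇒x²≈±y² x y =
    x²≈y²⇒x≈±y (x ^ 2) (y ^ 2) ∘ subst₂ _≈_ (sym (^-*-assoc x 2 2)) (sym (^-*-assoc y 2 2))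

  ≉0⇒invertible : ∀ {x} → ¬ x ≈ 0ℤ → ∃[ s ] s * x ≈ 1ℤ
  ≉0⇒invertible {x} x≉0 with residue x | ≈-residue x | residue<p x
  ... | zero  | x≈0 | _   = contradiction x≈0 x≉0
  ... | suc m | x≈m | m<p =
    let s , s*m≈1 = coprime⇒invertible (prime⇒coprime p-prime m<p) in s , ≈-trans (*-congˡ s x≈m) s*m≈1

  module _ {n : ℕ} (h : ℕ → ℤ) (h-injective : ∀ {i j} → i ℕ.< n → j ℕ.< n → h i ≈ h j → i ≡ j)
    where

    count-≈ : ∀ v → count (λ i → h i ≈? v) n ℕ.≤ 1
    count-≈ v = count-unique _ n λ i<n j<n hi≈v hj≈v →
      h-injective i<n j<n (≈-trans hi≈v (≈-sym hj≈v))

    count-square-roots : ∀ u → count (λ i → h i ^ 2 ≈? u) n ℕ.≤ 2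
    count-square-roots u = count≤-fromWitness _ n λ {i₀} _ hi₀²≈u → begin
      count (λ i → h i ^ 2 ≈? u) n
        ≤⟨ count-⊎ _ _ _ n (λ {i} _ hi²≈u → x²≈y²⇒x≈±y (h i) (h i₀) (≈-trans hi²≈u (≈-sym hi₀²≈u))) ⟩
      count (λ i → h i ≈? h i₀) n ℕ.+ count (λ i → h i ≈? - h i₀) n
        ≤⟨ ℕ.+-mono-≤ (count-≈ (h i₀)) (count-≈ (- h i₀)) ⟩
      2 ∎
      where open ℕ.≤-Reasoning

    count-fourth-roots : ∀ u → count (λ i → h i ^ 4 ≈? u) n ℕ.≤ 4
    count-fourth-roots u = count≤-fromWitness _ n λ {i₀} _ hi₀⁴≈u → begin
      count (λ i → h i ^ 4 ≈? u) n
        ≤⟨ count-⊎ _ _ _ n (λ {i} _ hi⁴≈u → x⁴≈y⁴⇒x²≈±y² (h i) (h i₀) (≈-trans hi⁴≈u (≈-sym hi₀⁴≈u))) ⟩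
      count (λ i → h i ^ 2 ≈? h i₀ ^ 2) n ℕ.+ count (λ i → h i ^ 2 ≈? - h i₀ ^ 2) n
        ≤⟨ ℕ.+-mono-≤ (count-square-roots _) (count-square-roots _) ⟩
      4 ∎
      where open ℕ.≤-Reasoning

  -- t < p ∸ 1 stands for the unit t + 1, so the image of scaled-fourth-power x is x·(𝔽ₚ×)⁴.
  scaled-fourth-power : ℤ → ℕ → ℕ
  scaled-fourth-power x t = residue (x * (+ suc t) ^ 4)

  #scaled-fourth-powers : ℤ → ℕ
  #scaled-fourth-powers x = count (image? (scaled-fourth-power x) (p ℕ.∸ 1)) p

  t<p∸1⇒1+t<p : ∀ {t} → t ℕ.< p ℕ.∸ 1 → suc t ℕ.< p
  t<p∸1⇒1+t<p t<p-1 = subst (suc _ ℕ.<_) (ℕ.suc-pred p) (s≤s t<p-1)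

  many-scaled-fourth-powers : ∀ {x} → ¬ x ≈ 0ℤ → p ℕ.∸ 1 ℕ.≤ 4 ℕ.* #scaled-fourth-powers x
  many-scaled-fourth-powers {x} x≉0 =
    count-image (scaled-fourth-power x) (p ℕ.∸ 1) p 4 (λ {t} _ → residue<p (x * (+ suc t) ^ 4)) fibre≤4
    where
    fibre≤4 : ∀ z → count (λ t → scaled-fourth-power x t ℕ.≟ z) (p ℕ.∸ 1) ℕ.≤ 4
    fibre≤4 z = count≤-fromWitness _ (p ℕ.∸ 1) λ {t₀} _ xt₀⁴≡z → begin
      count (λ t → scaled-fourth-power x t ℕ.≟ z) (p ℕ.∸ 1)
        ≤⟨ count-mono-≤ _ _ (p ℕ.∸ 1) (λ _ xt⁴≡z →
             *-cancelˡ-≈ x≉0 (residue-≡⇒≈ (trans xt⁴≡z (sym xt₀⁴≡z)))) ⟩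
      count (λ t → (+ suc t) ^ 4 ≈? (+ suc t₀) ^ 4) (p ℕ.∸ 1)
        ≤⟨ count-fourth-roots (λ t → + suc t) (λ i< j< i≈j →
             ℕ.suc-injective (≈⇒≡ (t<p∸1⇒1+t<p i<) (t<p∸1⇒1+t<p j<) i≈j)) _ ⟩
      4 ∎
      where open ℕ.≤-Reasoning

module DiagonalQuartic (p : ℕ) (p-prime : Prime p) where

  private instance
    p≢0 : NonZero p
    p≢0 = prime⇒nonZero p-prime

  open PrimeModulus p p-prime

  Represents : List ℤ → ℤ → Set
  Represents []       w = w ≈ 0ℤ
  Represents (c ∷ cs) w = ∃[ y ] Represents cs (w - c * y ^ 4)

  Represents-resp : ∀ cs {w w′} → w ≈ w′ → Represents cs w → Represents cs w′
  Represents-resp []       w≈w′ w≈0     = ≈-trans (≈-sym w≈w′) w≈0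
  Represents-resp (c ∷ cs) w≈w′ (y , r) = y , Represents-resp cs (+-cong w≈w′ ≈-refl) r

  represents? : ∀ cs → Decidable (Represents cs)
  represents? []       w = w ≈? 0ℤ
  represents? (c ∷ cs) w =
    map′ (λ (y , _ , r) → + y , r)
         (λ (y , r) → residue y , residue<p y ,
                      Represents-resp cs (-‿congʳ w (*-congˡ c (^-cong 4 (≈-residue y)))) r)
         (ℕ.anyUpTo? (λ y → represents? cs (w - c * (+ y) ^ 4)) p)

  represents-all? : ∀ cs → Dec (∀ w → Represents cs w)
  represents-all? cs =
    map′ (λ all-residues w → Represents-resp cs (≈-sym (≈-residue w)) (all-residues (residue<p w)))
         (λ all {z} _ → all (+ z))
         (ℕ.allUpTo? (λ z → represents? cs (+ z)) p)

  #represented : List ℤ → ℕ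
  #represented cs = count (λ z → represents? cs (+ z)) p

  Represents-0 : ∀ cs → Represents cs 0ℤ
  Represents-0 []       = ≈-refl
  Represents-0 (c ∷ cs) = 0ℤ , Represents-resp cs (≈-reflexive (identity c)) (Represents-0 cs)
    where
    identity : ∀ c → 0ℤ ≡ 0ℤ - c * 0ℤ
    identity = solve-∀

  Represents-∷ : ∀ c cs y {w} → Represents cs w → Represents (c ∷ cs) (w + c * y ^ 4)
  Represents-∷ c cs y {w} r = y , Represents-resp cs (≈-reflexive (identity w (c * y ^ 4))) r
    where
    identity : ∀ w z → w ≡ w + z - z
    identity = solve-∀

  Represents-extend : ∀ c cs {w} → Represents cs w → Represents (c ∷ cs) w
  Represents-extend c cs {w} r = 0ℤ , Represents-resp cs (≈-reflexive (identity w c)) r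
    where
    identity : ∀ w c → w ≡ w - c * 0ℤ
    identity = solve-∀

  Represents-*⁴ : ∀ cs t {w} → Represents cs w → Represents cs (w * t ^ 4)
  Represents-*⁴ []       t w≈0         = *-congʳ (t ^ 4) w≈0
  Represents-*⁴ (c ∷ cs) t {w} (y , r) =
    y * t , Represents-resp cs (≈-reflexive scale) (Represents-*⁴ cs t r)
    where
    identity : ∀ w c Y T → (w - c * Y) * T ≡ w * T - c * (Y * T)
    identity = solve-∀
    scale : (w - c * y ^ 4) * t ^ 4 ≡ w * t ^ 4 - c * (y * t) ^ 4
    scale = trans (identity w c (y ^ 4) (t ^ 4))
                  (cong (λ z → w * t ^ 4 - c * z) (sym (^-distrib-* y t 4)))

  Represents-*⁴⁻¹ : ∀ cs {t w} → ¬ t ≈ 0ℤ → Represents cs (w * t ^ 4) → Represents cs w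
  Represents-*⁴⁻¹ cs {t} {w} t≉0 r with ≉0⇒invertible t≉0
  ... | s , s*t≈1 = Represents-resp cs wt⁴s⁴≈w (Represents-*⁴ cs s r)
    where
    identity : ∀ w T S → w * T * S ≡ w * (S * T)
    identity = solve-∀
    open ≈-Reasoning
    wt⁴s⁴≈w : w * t ^ 4 * s ^ 4 ≈ w
    wt⁴s⁴≈w = begin
      w * t ^ 4 * s ^ 4   ≡⟨ identity w (t ^ 4) (s ^ 4) ⟩
      w * (s ^ 4 * t ^ 4) ≡⟨ cong (w *_) (^-distrib-* s t 4) ⟨
      w * (s * t) ^ 4     ≈⟨ *-congˡ w (^-cong 4 s*t≈1) ⟩
      w * 1ℤ              ≡⟨ *-identityʳ w ⟩
      w                   ∎

  module Extension (c : ℤ) (cs : List ℤ) where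

    stable⇒represents-all : ¬ c ≈ 0ℤ → (∀ w → Represents (c ∷ cs) w → Represents cs w) →
                            ∀ w → Represents cs w
    stable⇒represents-all c≉0 stable w with ≉0⇒invertible c≉0
    ... | s , s*c≈1 = Represents-resp cs kc≈w (multiples (residue (w * s)))
      where
      multiples : ∀ k → Represents cs (+ k * c)
      multiples zero    = Represents-0 cs
      multiples (suc k) = Represents-resp cs (≈-reflexive (identity (+ k) c))
                                          (stable _ (Represents-∷ c cs 1ℤ (multiples k)))
        where
        identity : ∀ k c → k * c + c * 1ℤ ≡ (+ 1 + k) * c
        identity = solve-∀
      open ≈-Reasoning
      kc≈w : + residue (w * s) * c ≈ w
      kc≈w = begin
        + residue (w * s) * c ≈⟨ *-congʳ c (≈-sym (≈-residue (w * s))) ⟩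
        w * s * c             ≡⟨ *-assoc w s c ⟩
        w * (s * c)           ≈⟨ *-congˡ w s*c≈1 ⟩
        w * 1ℤ                ≡⟨ *-identityʳ w ⟩
        w                     ∎

    New : ℕ → Set
    New x = Represents (c ∷ cs) (+ x) × ¬ Represents cs (+ x)

    new-value : ¬ c ≈ 0ℤ → ¬ (∀ w → Represents cs w) → ∃[ x ] x ℕ.< p × New x
    new-value c≉0 ¬all = decidable-stable (ℕ.anyUpTo? new? p) λ ∄x →
      ¬all (stable⇒represents-all c≉0 λ w r → Represents-resp cs (≈-sym (≈-residue w))
        (decidable-stable (represents? cs (+ residue w)) λ ¬old →
          ∄x (residue w , residue<p w , Represents-resp (c ∷ cs) (≈-residue w) r , ¬old)))
      where
      new? : Decidable New
      new? x = represents? (c ∷ cs) (+ x) ×-dec ¬? (represents? cs (+ x))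

    -- A new value x brings its whole coset x·(𝔽ₚ×)⁴ along, and that coset misses the old
    -- values because Represents cs is stable under multiplying and dividing by fourth powers.
    growth : ∀ {x} → Represents (c ∷ cs) (+ x) → ¬ Represents cs (+ x) →
             4 ℕ.* #represented cs ℕ.+ (p ℕ.∸ 1) ℕ.≤ 4 ℕ.* #represented (c ∷ cs)
    growth {x} new ¬old = begin
      4 ℕ.* #represented cs ℕ.+ (p ℕ.∸ 1)
        ≤⟨ ℕ.+-monoʳ-≤ (4 ℕ.* #represented cs) (many-scaled-fourth-powers x≉0) ⟩
      4 ℕ.* #represented cs ℕ.+ 4 ℕ.* #scaled-fourth-powers (+ x)
        ≡⟨ ℕ.*-distribˡ-+ 4 (#represented cs) (#scaled-fourth-powers (+ x)) ⟨
      4 ℕ.* (#represented cs ℕ.+ #scaled-fourth-powers (+ x))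
        ≤⟨ ℕ.*-monoʳ-≤ 4 (count-disjoint _ _ _ p old⇒new coset⇒new disjoint) ⟩
      4 ℕ.* #represented (c ∷ cs) ∎
      where
      open ℕ.≤-Reasoning
      Coset : ℕ → Set
      Coset = Image (scaled-fourth-power (+ x)) (p ℕ.∸ 1)
      x≉0 : ¬ + x ≈ 0ℤ
      x≉0 x≈0 = ¬old (Represents-resp cs (≈-sym x≈0) (Represents-0 cs))
      old⇒new : ∀ {z} → z ℕ.< p → Represents cs (+ z) → Represents (c ∷ cs) (+ z)
      old⇒new _ = Represents-extend c cs
      coset⇒new : ∀ {z} → z ℕ.< p → Coset z → Represents (c ∷ cs) (+ z)
      coset⇒new _ (t , _ , refl) =
        Represents-resp (c ∷ cs) (≈-residue (+ x * (+ suc t) ^ 4))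
                        (Represents-*⁴ (c ∷ cs) (+ suc t) {+ x} new)
      disjoint : ∀ {z} → z ℕ.< p → Represents cs (+ z) → Coset z → ⊥
      disjoint _ old (t , t<p-1 , refl) =
        ¬old (Represents-*⁴⁻¹ cs t≉0 (Represents-resp cs (≈-sym (≈-residue (+ x * (+ suc t) ^ 4))) old))
        where
        t≉0 : ¬ + suc t ≈ 0ℤ
        t≉0 = 0<m<p⇒m≉0 (s≤s z≤n) (t<p∸1⇒1+t<p t<p-1)

  represents-all-or-many : ∀ cs → All (λ c → ¬ c ≈ 0ℤ) cs →
    (∀ w → Represents cs w) ⊎ 4 ℕ.+ length cs ℕ.* (p ℕ.∸ 1) ℕ.≤ 4 ℕ.* #represented cs
  represents-all-or-many [] [] = inj₂ (ℕ.*-monoʳ-≤ 4 (begin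
    1                ≡⟨ count-≡ (ℕ.>-nonZero⁻¹ p) ⟨
    count (0 ℕ.≟_) p ≤⟨ count-mono-≤ _ _ p (λ { _ refl → ≈-refl }) ⟩
    #represented []  ∎))
    where open ℕ.≤-Reasoning
  represents-all-or-many (c ∷ cs) (c≉0 ∷ cs≉0) =
    extend (represents-all? cs) (represents-all-or-many cs cs≉0)
    where
    open Extension c cs
    extend : Dec (∀ w → Represents cs w) →
      (∀ w → Represents cs w) ⊎ 4 ℕ.+ length cs ℕ.* (p ℕ.∸ 1) ℕ.≤ 4 ℕ.* #represented cs →
      (∀ w → Represents (c ∷ cs) w) ⊎ 4 ℕ.+ suc (length cs) ℕ.* (p ℕ.∸ 1) ℕ.≤ 4 ℕ.* #represented (c ∷ cs)
    extend (yes all) _           = inj₁ (λ w → Represents-extend c cs (all w))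
    extend (no ¬all) (inj₁ all)  = contradiction all ¬all
    extend (no ¬all) (inj₂ many) = inj₂ (grow (new-value c≉0 ¬all))
      where
      grow : ∃[ x ] x ℕ.< p × New x → 4 ℕ.+ suc (length cs) ℕ.* (p ℕ.∸ 1) ℕ.≤ 4 ℕ.* #represented (c ∷ cs)
      grow (x , _ , new , ¬old) = begin
        4 ℕ.+ (q ℕ.+ length cs ℕ.* q)   ≡⟨ cong (4 ℕ.+_) (ℕ.+-comm q (length cs ℕ.* q)) ⟩
        4 ℕ.+ (length cs ℕ.* q ℕ.+ q)   ≡⟨ ℕ.+-assoc 4 (length cs ℕ.* q) q ⟨
        4 ℕ.+ length cs ℕ.* q ℕ.+ q     ≤⟨ ℕ.+-monoˡ-≤ q many ⟩
        4 ℕ.* #represented cs ℕ.+ q     ≤⟨ growth new ¬old ⟩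
        4 ℕ.* #represented (c ∷ cs)     ∎
        where
        open ℕ.≤-Reasoning
        q : ℕ
        q = p ℕ.∸ 1

  represents-all : ∀ cs → All (λ c → ¬ c ≈ 0ℤ) cs → 4 ℕ.≤ length cs → ∀ w → Represents cs w
  represents-all cs cs≉0 4≤length with represents-all-or-many cs cs≉0
  ... | inj₁ all  = all
  ... | inj₂ many = λ w →
    Represents-resp cs (≈-sym (≈-residue w)) (count≥n⇒all _ p p≤#represented (residue<p w))
    where
    open ℕ.≤-Reasoning
    p≤#represented : p ℕ.≤ #represented cs
    p≤#represented = ℕ.*-cancelˡ-≤ 4 (begin
      4 ℕ.* p                       ≡⟨ cong (4 ℕ.*_) (ℕ.suc-pred p) ⟨
      4 ℕ.* suc (p ℕ.∸ 1)           ≡⟨ ℕ.*-suc 4 (p ℕ.∸ 1) ⟩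
      4 ℕ.+ 4 ℕ.* (p ℕ.∸ 1)         ≤⟨ ℕ.+-monoʳ-≤ 4 (ℕ.*-monoˡ-≤ (p ℕ.∸ 1) 4≤length) ⟩
      4 ℕ.+ length cs ℕ.* (p ℕ.∸ 1) ≤⟨ many ⟩
      4 ℕ.* #represented cs         ∎)

Q≈a⇒Sol : ∀ {p} .{{_ : NonZero p}} → 1 ℕ.< p → ∀ a y₂ y₃ y₄ y₅ →
          Congruence._≈_ p (Q (+ 1) y₂ y₃ y₄ y₅) a → Sol p a (+ 1) y₂ y₃ y₄ y₅
Q≈a⇒Sol 1<p _ _ _ _ _ (Congruence.mk≈ p∣Q-a) =
  ∣⇒∣ᵤ p∣Q-a , λ (p∣1 , _) → ℕ.<⇒≱ 1<p (ℕ.∣⇒≤ p∣1)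

module _ (p : ℕ) (p-prime : Prime p) (7<p : 7 ℕ.< p) where

  open PrimeModulus p p-prime
  open DiagonalQuartic p p-prime

  private instance
    p≢0 : NonZero p
    p≢0 = prime⇒nonZero p-prime

  1,3,5,7≉0 : All (λ c → ¬ c ≈ 0ℤ) (+ 1 ∷ + 3 ∷ + 5 ∷ + 7 ∷ [])
  1,3,5,7≉0 = ≉0 (ℕ.m≤m+n 1 6) ∷ ≉0 (ℕ.m≤m+n 3 4) ∷ ≉0 (ℕ.m≤m+n 5 2) ∷ ≉0 ℕ.≤-refl ∷ []
    where
    ≉0 : ∀ {m} → suc m ℕ.≤ 7 → ¬ + suc m ≈ 0ℤ
    ≉0 m<7 = 0<m<p⇒m≉0 (s≤s z≤n) (ℕ.≤-<-trans m<7 7<p)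

  large-prime-solution : ∀ a → ∃[ y₁ ] ∃[ y₂ ] ∃[ y₃ ] ∃[ y₄ ] ∃[ y₅ ] Sol p a y₁ y₂ y₃ y₄ y₅
  large-prime-solution a = solution (represents-all _ 1,3,5,7≉0 ℕ.≤-refl (a - + 1))
    where
    identity : ∀ a Y₂ Y₃ Y₄ Y₅ → - ((((a - + 1 - + 1 * Y₂) - + 3 * Y₃) - + 5 * Y₄) - + 7 * Y₅) ≡
                                  + 1 + Y₂ + + 3 * Y₃ + + 5 * Y₄ + + 7 * Y₅ - a
    identity = solve-∀
    solution : Represents (+ 1 ∷ + 3 ∷ + 5 ∷ + 7 ∷ []) (a - + 1) →
               ∃[ y₁ ] ∃[ y₂ ] ∃[ y₃ ] ∃[ y₄ ] ∃[ y₅ ] Sol p a y₁ y₂ y₃ y₄ y₅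
    solution (y₂ , y₃ , y₄ , y₅ , r) = + 1 , y₂ , y₃ , y₄ , y₅ ,
      Q≈a⇒Sol (ℕ.≤-<-trans (s≤s z≤n) 7<p) a y₂ y₃ y₄ y₅
        (-≈0⇒≈ (subst (_≈ 0ℤ) (identity a (y₂ ^ 4) (y₃ ^ 4) (y₄ ^ 4) (y₅ ^ 4)) (-‿cong r)))

module Mod3 where

  open Congruence 3

  Q-residues : ∀ r → r ℕ.< 3 → ∃[ y₂ ] ∃[ y₄ ] ∃[ y₅ ] Q (+ 1) y₂ (+ 0) y₄ y₅ ≈ + r
  Q-residues 0 _ = + 0 , + 1 , + 0 , mk≈ (divides (+ 2) refl)
  Q-residues 1 _ = + 0 , + 0 , + 0 , mk≈ (divides (+ 0) refl)
  Q-residues 2 _ = + 1 , + 0 , + 0 , mk≈ (divides (+ 0) refl)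
  Q-residues (suc (suc (suc _))) (s≤s (s≤s (s≤s ())))

  solution : ∀ a → ∃[ y₁ ] ∃[ y₂ ] ∃[ y₄ ] ∃[ y₅ ] Sol 3 a y₁ y₂ (+ 0) y₄ y₅
  solution a with Q-residues (residue a) (residue<p a)
  ... | y₂ , y₄ , y₅ , Q≈r =
    + 1 , y₂ , y₄ , y₅ , Q≈a⇒Sol (s≤s (s≤s z≤n)) a y₂ (+ 0) y₄ y₅ (≈-trans Q≈r (≈-sym (≈-residue a)))

module Mod5 where

  open Congruence 5

  Q-residues : ∀ r → r ℕ.< 5 → ∃[ y₂ ] ∃[ y₃ ] ∃[ y₅ ] Q (+ 1) y₂ y₃ (+ 0) y₅ ≈ + r
  Q-residues 0 _ = + 1 , + 1 , + 0 , mk≈ (divides (+ 1) refl)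
  Q-residues 1 _ = + 0 , + 0 , + 0 , mk≈ (divides (+ 0) refl)
  Q-residues 2 _ = + 1 , + 0 , + 0 , mk≈ (divides (+ 0) refl)
  Q-residues 3 _ = + 0 , + 0 , + 1 , mk≈ (divides (+ 1) refl)
  Q-residues 4 _ = + 0 , + 1 , + 0 , mk≈ (divides (+ 0) refl)
  Q-residues (suc (suc (suc (suc (suc _))))) (s≤s (s≤s (s≤s (s≤s (s≤s ())))))

  solution : ∀ a → ∃[ y₁ ] ∃[ y₂ ] ∃[ y₃ ] ∃[ y₅ ] Sol 5 a y₁ y₂ y₃ (+ 0) y₅
  solution a with Q-residues (residue a) (residue<p a)
  ... | y₂ , y₃ , y₅ , Q≈r =
    + 1 , y₂ , y₃ , y₅ , Q≈a⇒Sol (s≤s (s≤s z≤n)) a y₂ y₃ (+ 0) y₅ (≈-trans Q≈r (≈-sym (≈-residue a)))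

module Mod7 where

  open Congruence 7

  Q-residues : ∀ r → r ℕ.< 7 → ∃[ y₂ ] ∃[ y₃ ] ∃[ y₄ ] Q (+ 1) y₂ y₃ y₄ (+ 0) ≈ + r
  Q-residues 0 _ = + 1 , + 0 , + 1 , mk≈ (divides (+ 1) refl)
  Q-residues 1 _ = + 0 , + 0 , + 0 , mk≈ (divides (+ 0) refl)
  Q-residues 2 _ = + 1 , + 0 , + 0 , mk≈ (divides (+ 0) refl)
  Q-residues 3 _ = + 2 , + 0 , + 0 , mk≈ (divides (+ 2) refl)
  Q-residues 4 _ = + 0 , + 1 , + 0 , mk≈ (divides (+ 0) refl)
  Q-residues 5 _ = + 3 , + 0 , + 0 , mk≈ (divides (+ 11) refl)
  Q-residues 6 _ = + 0 , + 0 , + 1 , mk≈ (divides (+ 0) refl)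
  Q-residues (suc (suc (suc (suc (suc (suc (suc _))))))) (s≤s (s≤s (s≤s (s≤s (s≤s (s≤s (s≤s ())))))))

  solution : ∀ a → ∃[ y₁ ] ∃[ y₂ ] ∃[ y₃ ] ∃[ y₄ ] Sol 7 a y₁ y₂ y₃ y₄ (+ 0)
  solution a with Q-residues (residue a) (residue<p a)
  ... | y₂ , y₃ , y₄ , Q≈r =
    + 1 , y₂ , y₃ , y₄ , Q≈a⇒Sol (s≤s (s≤s z≤n)) a y₂ y₃ y₄ (+ 0) (≈-trans Q≈r (≈-sym (≈-residue a)))

odd-prime-cases : ∀ {p} → Prime p → p ≢ 2 → p ≡ 3 ⊎ p ≡ 5 ⊎ p ≡ 7 ⊎ 7 ℕ.< p
odd-prime-cases {0} p-prime _ = contradiction p-prime ¬prime[0]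
odd-prime-cases {1} p-prime _ = contradiction p-prime ¬prime[1]
odd-prime-cases {2} _ p≢2 = contradiction refl p≢2
odd-prime-cases {3} _ _ = inj₁ refl
odd-prime-cases {4} p-prime _ =
  contradiction (prime⇒irreducible p-prime {2} (ℕ.divides 2 refl)) λ { (inj₁ ()) ; (inj₂ ()) }
odd-prime-cases {5} _ _ = inj₂ (inj₁ refl)
odd-prime-cases {6} p-prime _ =
  contradiction (prime⇒irreducible p-prime {2} (ℕ.divides 3 refl)) λ { (inj₁ ()) ; (inj₂ ()) }
odd-prime-cases {7} _ _ = inj₂ (inj₂ (inj₁ refl))
odd-prime-cases {suc (suc (suc (suc (suc (suc (suc (suc k)))))))} _ _ =
  inj₂ (inj₂ (inj₂ (ℕ.m≤m+n 8 k)))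

lemma7p2 : (p : ℕ) → Prime p → p ≢ 2 → (a : ℤ) →
    (∃[ y₁ ] ∃[ y₂ ] ∃[ y₃ ] ∃[ y₄ ] ∃[ y₅ ] Sol p a y₁ y₂ y₃ y₄ y₅)
    × (p ≡ 3 → ∃[ y₁ ] ∃[ y₂ ] ∃[ y₄ ] ∃[ y₅ ] Sol p a y₁ y₂ (+ 0) y₄ y₅)
    × (p ≡ 5 → ∃[ y₁ ] ∃[ y₂ ] ∃[ y₃ ] ∃[ y₅ ] Sol p a y₁ y₂ y₃ (+ 0) y₅)
    × (p ≡ 7 → ∃[ y₁ ] ∃[ y₂ ] ∃[ y₃ ] ∃[ y₄ ] Sol p a y₁ y₂ y₃ y₄ (+ 0))
lemma7p2 p p-prime p≢2 a with odd-prime-cases p-prime p≢2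
... | inj₁ refl =
  let y₁ , y₂ , y₄ , y₅ , s = Mod3.solution a in
  (y₁ , y₂ , + 0 , y₄ , y₅ , s) , (λ _ → y₁ , y₂ , y₄ , y₅ , s) , (λ ()) , (λ ())
... | inj₂ (inj₁ refl) =
  let y₁ , y₂ , y₃ , y₅ , s = Mod5.solution a in
  (y₁ , y₂ , y₃ , + 0 , y₅ , s) , (λ ()) , (λ _ → y₁ , y₂ , y₃ , y₅ , s) , (λ ())
... | inj₂ (inj₂ (inj₁ refl)) =
  let y₁ , y₂ , y₃ , y₄ , s = Mod7.solution a in
  (y₁ , y₂ , y₃ , y₄ , + 0 , s) , (λ ()) , (λ ()) , (λ _ → y₁ , y₂ , y₃ , y₄ , s)
... | inj₂ (inj₂ (inj₂ 7<p)) =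
  large-prime-solution p p-prime 7<p a ,
  excluded (ℕ.m≤m+n 3 4) , excluded (ℕ.m≤m+n 5 2) , excluded ℕ.≤-refl
  where
  excluded : ∀ {q} {A : Set} → q ℕ.≤ 7 → p ≡ q → A
  excluded q≤7 refl = contradiction q≤7 (ℕ.<⇒≱ 7<p)
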